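{- Let $T^{id}(z,u)=\sum_t z^{|t|}u^{\mathrm{id}(t)}$, the sum ranging over closed linear $\lambda$-terms $t$ (up to $\alpha$-equivalence), where $\mathrm{id}(t)$ is the number of identity-subterm occurrences of $t$. Then $$T^{id}(z,u) = (u-1)z^2 + zT^{id}(z,u)^2 + \frac{\partial}{\partial u}T^{id}(z,u).$$
   Context: $\lambda$-terms are built from variables, applications $(t~u)$ and abstractions $\lambda x.t$. A term is linear if each variable is used exactly once, and closed if it has no free variables. Size is defined by $|x|=1$, $|(t~u)|=1+|t|+|u|$, $|\lambda x.t|=1+|t|$. An identity-subterm is a subterm occurrence (possibly the whole term) $\alpha$-equivalent to $\lambda x.x$. -}

module Defs where

open import Data.Nat as ℕ using (ℕ; zero; suc; _≡ᵇ_; _∸_)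
open import Data.Integer as ℤ using (ℤ; +_; -_)
open import Data.Fin using (Fin; zero; suc)
open import Data.Bool using (Bool; true; false; _∧_)
open import Data.List using (List; []; _∷_; _++_; map; concatMap; filter; length; allFin; foldr; upTo)
open import Relation.Nullary.Decidable using (Dec; yes; no)
open import Relation.Binary.PropositionalEquality using (_≡_)
open import Data.Bool using (T)
open import Data.Bool.Properties using (T?)

-- λ-terms up to α-equivalence: de Bruijn indices.
-- Term m = terms whose free variables are among m variables.
-- Closed terms are Term 0.

data Term (m : ℕ) : Set where
  var : Fin m → Term m
  app : Term m → Term m → Term m
  lam : Term (suc m) → Term m

size : ∀ {m} → Term m → ℕ
size (var _)   = 1
size (app t u) = suc (size t ℕ.+ size u)
size (lam t)   = suc (size t)

eqFin : ∀ {m} → Fin m → Fin m → Bool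
eqFin zero    zero    = true
eqFin zero    (suc _) = false
eqFin (suc _) zero    = false
eqFin (suc i) (suc j) = eqFin i j

occ : ∀ {m} → Fin m → Term m → ℕ
occ i (var j)   = if′ (eqFin i j)
  where
  if′ : Bool → ℕ
  if′ true  = 1
  if′ false = 0
occ i (app t u) = occ i t ℕ.+ occ i u
occ i (lam t)   = occ (suc i) t

isLinear : ∀ {m} → Term m → Bool
isLinear (var _)   = true
isLinear (app t u) = isLinear t ∧ isLinear u
isLinear (lam t)   = isLinear t ∧ (occ zero t ≡ᵇ 1)

idCount : ∀ {m} → Term m → ℕ
idCount (var _)        = 0
idCount (app t u)      = idCount t ℕ.+ idCount u
idCount (lam (var zero)) = 1
idCount (lam t)        = idCount t

-- all terms of depth ≤ b (each exactly once); contains every term of size ≤ b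
termsUpTo : (b m : ℕ) → List (Term m)
termsUpTo zero    m = []
termsUpTo (suc b) m =
  map var (allFin m)
  ++ concatMap (λ t → map (app t) (termsUpTo b m)) (termsUpTo b m)
  ++ map lam (termsUpTo b (suc m))

countTid : ℕ → ℕ → ℕ
countTid n k = length (filter (λ t → T? (isLinear t ∧ (size t ≡ᵇ n) ∧ (idCount t ≡ᵇ k)))
                              (termsUpTo n 0))

-- Formal power series in z, u with integer coefficients:
-- f n k = coefficient of z^n u^k.

FPS : Set
FPS = ℕ → ℕ → ℤ

_≈_ : FPS → FPS → Set
f ≈ g = ∀ n k → f n k ≡ g n k
infix 4 _≈_

sumℤ : List ℤ → ℤ
sumℤ = foldr ℤ._+_ (+ 0)

_⊕_ : FPS → FPS → FPS
(f ⊕ g) n k = f n k ℤ.+ g n k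

_⊖_ : FPS → FPS → FPS
(f ⊖ g) n k = f n k ℤ.- g n k

_⊛_ : FPS → FPS → FPS
(f ⊛ g) n k = sumℤ (map (λ i → sumℤ (map (λ j → f i j ℤ.* g (n ∸ i) (k ∸ j)) (upTo (suc k)))) (upTo (suc n)))

infixl 6 _⊕_ _⊖_
infixl 7 _⊛_

mono : ℕ → ℕ → FPS
mono a b n k with a ℕ.≡ᵇ n | b ℕ.≡ᵇ k
... | true | true = + 1
... | _    | _    = + 0

Z U One : FPS
Z = mono 1 0
U = mono 0 1
One = mono 0 0

∂u : FPS → FPS
∂u f n k = (+ suc k) ℤ.* f n (suc k)

Tid : FPS
Tid n k = + countTid n k

-- Split the closed linear terms of size n + 1 by their root. Applications t u give the
-- coefficients of z·T². An abstraction λs is linear iff its body s is linear and uses the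
-- bound variable exactly once, and it has as many identities as s except for λx.x itself,
-- which is what the correction (u − 1)z² accounts for. The coefficient (k + 1)·T(n+1, k+1)
-- of ∂T/∂u counts terms with k + 1 identities one of which is marked; replacing the marked
-- identity by a fresh free variable is a bijection onto the bodies s of size n with k
-- identities. The bijection is established on sums, by induction on size: summing over
-- all one-identity replacements of the terms of size n + 1 equals summing over the terms
-- of size n in which the fresh variable occurs exactly once.

module Submission where

open import Defs
open import Data.Bool using (Bool; true; false; _∧_)
open import Data.Bool.Properties using (T?)
open import Data.Fin using (Fin; zero; suc; fromℕ; inject₁)
open import Data.Integer as ℤ using (ℤ; +_)
import Data.Integer.Properties as ℤ
import Data.Integer.Tactic.RingSolver as ℤ-Solver
open import Data.List using (List; []; _∷_; _++_; map; concatMap; filter; length; allFin; upTo; applyUpTo)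
open import Data.List.Properties using (length-++; length-map; map-cong; map-upTo; map-applyUpTo; map-tabulate)
open import Data.List.Relation.Unary.All as All using (All; []; _∷_; universal)
open import Data.List.Relation.Unary.All.Properties using (++⁺; map⁺)
open import Data.Nat using (ℕ; zero; suc; _≡ᵇ_; _∸_; _+_; _*_; _≤_; _<_; z≤n; s≤s)
open import Data.Nat.Induction using (<-rec)
open import Data.Nat.ListAction using (sum)
open import Data.Nat.Properties
  using (+-assoc; +-identityʳ; +-suc; *-assoc; *-comm; *-identityˡ; *-zeroʳ; *-distribˡ-+; ≤-refl; ≤-trans; m≤m+n; m≤n+m; m∸n≤m)
open import Data.Nat.Tactic.RingSolver using (solve-∀)
open import Data.Product using (_×_; _,_)
open import Function using (_∘_; id)
open import Relation.Binary.PropositionalEquality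
open ≡-Reasoning

𝟙 : Bool → ℕ
𝟙 true  = 1
𝟙 false = 0

𝟙-∧ : ∀ a b → 𝟙 (a ∧ b) ≡ 𝟙 a * 𝟙 b
𝟙-∧ true  true  = refl
𝟙-∧ true  false = refl
𝟙-∧ false _     = refl

m*𝟙[m≡ᵇn]≡n*𝟙[m≡ᵇn] : ∀ m n → m * 𝟙 (m ≡ᵇ n) ≡ n * 𝟙 (m ≡ᵇ n)
m*𝟙[m≡ᵇn]≡n*𝟙[m≡ᵇn] zero    zero    = refl
m*𝟙[m≡ᵇn]≡n*𝟙[m≡ᵇn] zero    (suc n) = sym (*-zeroʳ (suc n))
m*𝟙[m≡ᵇn]≡n*𝟙[m≡ᵇn] (suc m) zero    = *-zeroʳ (suc m)
m*𝟙[m≡ᵇn]≡n*𝟙[m≡ᵇn] (suc m) (suc n) = cong (_+_ (𝟙 (m ≡ᵇ n))) (m*𝟙[m≡ᵇn]≡n*𝟙[m≡ᵇn] m n)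

𝟙[m+n≡ᵇ0] : ∀ m n → 𝟙 (m + n ≡ᵇ 0) ≡ 𝟙 (m ≡ᵇ 0) * 𝟙 (n ≡ᵇ 0)
𝟙[m+n≡ᵇ0] zero    zero    = refl
𝟙[m+n≡ᵇ0] zero    (suc n) = refl
𝟙[m+n≡ᵇ0] (suc m) n       = refl

𝟙[m+n≡ᵇ1] : ∀ m n → 𝟙 (m + n ≡ᵇ 1) ≡ 𝟙 (m ≡ᵇ 1) * 𝟙 (n ≡ᵇ 0) + 𝟙 (m ≡ᵇ 0) * 𝟙 (n ≡ᵇ 1)
𝟙[m+n≡ᵇ1] zero          zero          = refl
𝟙[m+n≡ᵇ1] zero          (suc zero)    = refl
𝟙[m+n≡ᵇ1] zero          (suc (suc n)) = refl
𝟙[m+n≡ᵇ1] (suc zero)    zero          = refl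
𝟙[m+n≡ᵇ1] (suc zero)    (suc n)       = refl
𝟙[m+n≡ᵇ1] (suc (suc m)) n             = refl

x*[y*z]≡y*[x*z] : ∀ x y z → x * (y * z) ≡ y * (x * z)
x*[y*z]≡y*[x*z] = solve-∀

private variable
  A B : Set

∑ : List A → (A → ℕ) → ℕ
∑ xs f = sum (map f xs)

∑-cong : ∀ (xs : List A) {f g : A → ℕ} → (∀ x → f x ≡ g x) → ∑ xs f ≡ ∑ xs g
∑-cong []       f≗g = refl
∑-cong (x ∷ xs) f≗g = cong₂ _+_ (f≗g x) (∑-cong xs f≗g)

∑-zero : ∀ (xs : List A) {f : A → ℕ} → (∀ x → f x ≡ 0) → ∑ xs f ≡ 0
∑-zero []       f≗0 = refl
∑-zero (x ∷ xs) f≗0 = cong₂ _+_ (f≗0 x) (∑-zero xs f≗0)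

∑-const : ∀ (xs : List A) {f : A → ℕ} {c} → All (λ x → f x ≡ c) xs → ∑ xs f ≡ length xs * c
∑-const []       []         = refl
∑-const (x ∷ xs) (fx≡c ∷ p) = cong₂ _+_ fx≡c (∑-const xs p)

∑-++ : ∀ (xs ys : List A) f → ∑ (xs ++ ys) f ≡ ∑ xs f + ∑ ys f
∑-++ []       ys f = refl
∑-++ (x ∷ xs) ys f = trans (cong (_+_ (f x)) (∑-++ xs ys f)) (sym (+-assoc (f x) _ _))

∑-map : ∀ (g : A → B) (xs : List A) f → ∑ (map g xs) f ≡ ∑ xs (f ∘ g)
∑-map g []       f = refl
∑-map g (x ∷ xs) f = cong (_+_ (f (g x))) (∑-map g xs f)

∑-concatMap : ∀ (g : A → List B) (xs : List A) f → ∑ (concatMap g xs) f ≡ ∑ xs (λ x → ∑ (g x) f)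
∑-concatMap g []       f = refl
∑-concatMap g (x ∷ xs) f = trans (∑-++ (g x) (concatMap g xs) f) (cong (_+_ (∑ (g x) f)) (∑-concatMap g xs f))

∑-+ : ∀ (xs : List A) f g → ∑ xs (λ x → f x + g x) ≡ ∑ xs f + ∑ xs g
∑-+ []       f g = refl
∑-+ (x ∷ xs) f g = trans (cong (_+_ (f x + g x)) (∑-+ xs f g)) (interchange (f x) (g x) (∑ xs f) (∑ xs g))
  where
  interchange : ∀ a b c d → a + b + (c + d) ≡ a + c + (b + d)
  interchange = solve-∀

∑-*ˡ : ∀ (xs : List A) k f → ∑ xs (λ x → k * f x) ≡ k * ∑ xs f
∑-*ˡ []       k f = sym (*-zeroʳ k)
∑-*ˡ (x ∷ xs) k f = trans (cong (_+_ (k * f x)) (∑-*ˡ xs k f)) (sym (*-distribˡ-+ k (f x) _))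

∑-swap : ∀ (xs : List A) (ys : List B) (f : A → B → ℕ) →
  ∑ xs (λ x → ∑ ys (f x)) ≡ ∑ ys (λ y → ∑ xs (λ x → f x y))
∑-swap []       ys f = sym (∑-zero ys (λ _ → refl))
∑-swap (x ∷ xs) ys f = trans (cong (_+_ (∑ ys (f x))) (∑-swap xs ys f)) (sym (∑-+ ys (f x) _))

length-filter≡∑𝟙 : ∀ (p : A → Bool) (xs : List A) → length (filter (T? ∘ p) xs) ≡ ∑ xs (𝟙 ∘ p)
length-filter≡∑𝟙 p []       = refl
length-filter≡∑𝟙 p (x ∷ xs) with p x
... | true  = cong suc (length-filter≡∑𝟙 p xs)
... | false = length-filter≡∑𝟙 p xs

∑-allFin-suc : ∀ n (f : Fin (suc n) → ℕ) → ∑ (allFin (suc n)) f ≡ f zero + ∑ (allFin n) (f ∘ suc)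
∑-allFin-suc n f = cong (λ xs → f zero + sum xs) (trans (map-tabulate suc f) (sym (map-tabulate id (f ∘ suc))))

∑-upTo-suc : ∀ n (f : ℕ → ℕ) → ∑ (upTo (suc n)) f ≡ f 0 + ∑ (upTo n) (f ∘ suc)
∑-upTo-suc n f = cong (λ xs → f 0 + sum xs) (trans (map-applyUpTo suc f n) (sym (map-upTo (f ∘ suc) n)))

-- Opaque, so that unification recovers the summand F from conv n F.
opaque
  conv : ℕ → (ℕ → ℕ → ℕ) → ℕ
  conv n F = ∑ (upTo (suc n)) (λ i → F i (n ∸ i))

opaque
  unfolding conv

  conv≡∑upTo : ∀ n F → conv n F ≡ ∑ (upTo (suc n)) (λ i → F i (n ∸ i))
  conv≡∑upTo n F = refl

  conv-0 : ∀ F → conv 0 F ≡ F 0 0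
  conv-0 F = +-identityʳ (F 0 0)

  conv-suc : ∀ n F → conv (suc n) F ≡ F 0 (suc n) + conv n (λ i j → F (suc i) j)
  conv-suc n F = ∑-upTo-suc (suc n) (λ i → F i (suc n ∸ i))

  conv-zero : ∀ n {F} → (∀ i j → F i j ≡ 0) → conv n F ≡ 0
  conv-zero n F≗0 = ∑-zero (upTo (suc n)) (λ i → F≗0 i (n ∸ i))

  conv-+ : ∀ n F G → conv n (λ i j → F i j + G i j) ≡ conv n F + conv n G
  conv-+ n F G = ∑-+ (upTo (suc n)) (λ i → F i (n ∸ i)) (λ i → G i (n ∸ i))

  conv-*ˡ : ∀ n k F → conv n (λ i j → k * F i j) ≡ k * conv n F
  conv-*ˡ n k F = ∑-*ˡ (upTo (suc n)) k (λ i → F i (n ∸ i))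

  ∑-conv : ∀ (xs : List A) n (F : A → ℕ → ℕ → ℕ) → ∑ xs (λ x → conv n (F x)) ≡ conv n (λ i j → ∑ xs (λ x → F x i j))
  ∑-conv xs n F = ∑-swap xs (upTo (suc n)) (λ x i → F x i (n ∸ i))

conv-sucʳ : ∀ n F → conv (suc n) F ≡ conv n (λ i j → F i (suc j)) + F (suc n) 0
conv-sucʳ zero    F = trans (conv-suc 0 F) (trans (cong (_+_ (F 0 1)) (conv-0 _)) (cong (_+ F 1 0) (sym (conv-0 _))))
conv-sucʳ (suc n) F = begin
  conv (suc (suc n)) F
    ≡⟨ conv-suc (suc n) F ⟩
  F 0 (suc (suc n)) + conv (suc n) (λ i j → F (suc i) j)
    ≡⟨ cong (_+_ (F 0 (suc (suc n)))) (conv-sucʳ n (λ i j → F (suc i) j)) ⟩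
  F 0 (suc (suc n)) + (conv n (λ i j → F (suc i) (suc j)) + F (suc (suc n)) 0)
    ≡⟨ +-assoc (F 0 (suc (suc n))) _ _ ⟨
  F 0 (suc (suc n)) + conv n (λ i j → F (suc i) (suc j)) + F (suc (suc n)) 0
    ≡⟨ cong (_+ F (suc (suc n)) 0) (conv-suc n (λ i j → F i (suc j))) ⟨
  conv (suc n) (λ i j → F i (suc j)) + F (suc (suc n)) 0 ∎

conv-cong : ∀ n {F G : ℕ → ℕ → ℕ} → (∀ i → i ≤ n → F i (n ∸ i) ≡ G i (n ∸ i)) → conv n F ≡ conv n G
conv-cong zero    {F} {G} F≗G = trans (conv-0 F) (trans (F≗G 0 z≤n) (sym (conv-0 G)))
conv-cong (suc n) {F} {G} F≗G = begin
  conv (suc n) F                                    ≡⟨ conv-suc n F ⟩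
  F 0 (suc n) + conv n (λ i j → F (suc i) j)        ≡⟨ cong₂ _+_ (F≗G 0 z≤n) (conv-cong n (λ i i≤n → F≗G (suc i) (s≤s i≤n))) ⟩
  G 0 (suc n) + conv n (λ i j → G (suc i) j)        ≡⟨ sym (conv-suc n G) ⟩
  conv (suc n) G                                    ∎

𝟙[m+n≡ᵇa]≡conv : ∀ a m n → 𝟙 (m + n ≡ᵇ a) ≡ conv a (λ i j → 𝟙 (m ≡ᵇ i) * 𝟙 (n ≡ᵇ j))
𝟙[m+n≡ᵇa]≡conv zero    m       n       = trans (𝟙[m+n≡ᵇ0] m n) (sym (conv-0 _))
𝟙[m+n≡ᵇa]≡conv (suc a) zero    n       = sym (begin
  conv (suc a) (λ i j → 𝟙 (0 ≡ᵇ i) * 𝟙 (n ≡ᵇ j))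
    ≡⟨ conv-suc a (λ i j → 𝟙 (0 ≡ᵇ i) * 𝟙 (n ≡ᵇ j)) ⟩
  1 * 𝟙 (n ≡ᵇ suc a) + conv a (λ i j → 𝟙 (0 ≡ᵇ suc i) * 𝟙 (n ≡ᵇ j))
    ≡⟨ cong₂ _+_ (*-identityˡ _) (conv-zero a (λ _ _ → refl)) ⟩
  𝟙 (n ≡ᵇ suc a) + 0
    ≡⟨ +-identityʳ _ ⟩
  𝟙 (n ≡ᵇ suc a) ∎)
𝟙[m+n≡ᵇa]≡conv (suc a) (suc m) n = trans (𝟙[m+n≡ᵇa]≡conv a m n) (sym (conv-suc a (λ i j → 𝟙 (suc m ≡ᵇ i) * 𝟙 (n ≡ᵇ j))))

∑depth≤ : ∀ {m} → ℕ → (Term m → ℕ) → ℕ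
∑depth≤ {m} b g = ∑ (termsUpTo b m) g

-- A term of size n has depth at most n, so termsUpTo n m lists every term of size n exactly once.
∑size : ∀ {m} → ℕ → (Term m → ℕ) → ℕ
∑size n g = ∑depth≤ n (λ t → 𝟙 (size t ≡ᵇ n) * g t)

∑depth≤-suc : ∀ b {m} (g : Term m → ℕ) → ∑depth≤ (suc b) g ≡
  ∑ (allFin m) (g ∘ var) + (∑depth≤ b (λ t → ∑depth≤ b (λ u → g (app t u))) + ∑depth≤ b (g ∘ lam))
∑depth≤-suc b {m} g = begin
  ∑ (vars ++ apps ++ lams) g                 ≡⟨ ∑-++ vars (apps ++ lams) g ⟩
  ∑ vars g + ∑ (apps ++ lams) g              ≡⟨ cong₂ _+_ (∑-map var (allFin m) g) (∑-++ apps lams g) ⟩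
  ∑ (allFin m) (g ∘ var) + (∑ apps g + ∑ lams g)
    ≡⟨ cong (λ x → ∑ (allFin m) (g ∘ var) + x) (cong₂ _+_ appsSum (∑-map lam (termsUpTo b (suc m)) g)) ⟩
  ∑ (allFin m) (g ∘ var) + (∑depth≤ b (λ t → ∑depth≤ b (λ u → g (app t u))) + ∑depth≤ b (g ∘ lam)) ∎
  where
  vars = map var (allFin m)
  apps = concatMap (λ t → map (app t) (termsUpTo b m)) (termsUpTo b m)
  lams = map lam (termsUpTo b (suc m))
  appsSum : ∑ apps g ≡ ∑depth≤ b (λ t → ∑depth≤ b (λ u → g (app t u)))
  appsSum = trans (∑-concatMap _ (termsUpTo b m) g) (∑-cong (termsUpTo b m) (λ t → ∑-map (app t) (termsUpTo b m) g))

0<size : ∀ {m} (t : Term m) → 0 < size t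
0<size (var _)   = s≤s z≤n
0<size (app _ _) = s≤s z≤n
0<size (lam _)   = s≤s z≤n

VanishesAbove : ∀ {m} → ℕ → (Term m → ℕ) → Set
VanishesAbove a g = ∀ t → a < size t → g t ≡ 0

∑depth≤-stable : ∀ {m} a b b′ (g : Term m → ℕ) → VanishesAbove a g → a ≤ b → a ≤ b′ → ∑depth≤ b g ≡ ∑depth≤ b′ g
∑depth≤-stable {m} zero b b′ g g≈0 _ _ =
  trans (∑-zero (termsUpTo b m) (λ t → g≈0 t (0<size t))) (sym (∑-zero (termsUpTo b′ m) (λ t → g≈0 t (0<size t))))
∑depth≤-stable {m} (suc a) (suc b) (suc b′) g g≈0 (s≤s a≤b) (s≤s a≤b′) = begin
  ∑depth≤ (suc b) g   ≡⟨ ∑depth≤-suc b g ⟩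
  _                   ≡⟨ cong (_+_ (∑ (allFin m) (g ∘ var))) (cong₂ _+_ apps lams) ⟩
  _                   ≡⟨ sym (∑depth≤-suc b′ g) ⟩
  ∑depth≤ (suc b′) g  ∎
  where
  stable : ∀ {m′} (h : Term m′ → ℕ) → VanishesAbove a h → ∑depth≤ b h ≡ ∑depth≤ b′ h
  stable h h≈0 = ∑depth≤-stable a b b′ h h≈0 a≤b a≤b′
  apps : ∑depth≤ b (λ t → ∑depth≤ b (λ u → g (app t u))) ≡ ∑depth≤ b′ (λ t → ∑depth≤ b′ (λ u → g (app t u)))
  apps = trans (∑-cong (termsUpTo b m) (λ t → stable (λ u → g (app t u)) (λ u a<u → g≈0 (app t u) (s≤s (≤-trans a<u (m≤n+m _ _))))))
               (stable (λ t → ∑depth≤ b′ (λ u → g (app t u)))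
                       (λ t a<t → ∑-zero (termsUpTo b′ m) (λ u → g≈0 (app t u) (s≤s (≤-trans a<t (m≤m+n _ _))))))
  lams : ∑depth≤ b (g ∘ lam) ≡ ∑depth≤ b′ (g ∘ lam)
  lams = stable (g ∘ lam) (λ s a<s → g≈0 (lam s) (s≤s a<s))

<⇒≡ᵇ≡false : ∀ n a → a < n → (n ≡ᵇ a) ≡ false
<⇒≡ᵇ≡false (suc n) zero    _         = refl
<⇒≡ᵇ≡false (suc n) (suc a) (s≤s a<n) = <⇒≡ᵇ≡false n a a<n

∑size-depth : ∀ {m} a b (g : Term m → ℕ) → a ≤ b → ∑depth≤ b (λ t → 𝟙 (size t ≡ᵇ a) * g t) ≡ ∑size a g
∑size-depth a b g a≤b =
  ∑depth≤-stable a b a _ (λ t a<t → cong (λ x → 𝟙 x * g t) (<⇒≡ᵇ≡false (size t) a a<t)) a≤b ≤-refl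

module _ {m : ℕ} (a : ℕ) where

  ∑size-cong : {g h : Term m → ℕ} → (∀ t → g t ≡ h t) → ∑size a g ≡ ∑size a h
  ∑size-cong g≗h = ∑-cong (termsUpTo a m) (λ t → cong (𝟙 (size t ≡ᵇ a) *_) (g≗h t))

  ∑size-zero : {g : Term m → ℕ} → (∀ t → g t ≡ 0) → ∑size a g ≡ 0
  ∑size-zero g≗0 = ∑-zero (termsUpTo a m) (λ t → trans (cong (𝟙 (size t ≡ᵇ a) *_) (g≗0 t)) (*-zeroʳ (𝟙 (size t ≡ᵇ a))))

  ∑size-+ : (g h : Term m → ℕ) → ∑size a (λ t → g t + h t) ≡ ∑size a g + ∑size a h
  ∑size-+ g h = trans (∑-cong (termsUpTo a m) (λ t → *-distribˡ-+ (𝟙 (size t ≡ᵇ a)) (g t) (h t))) (∑-+ (termsUpTo a m) _ _)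

  ∑size-*ˡ : ∀ k (g : Term m → ℕ) → ∑size a (λ t → k * g t) ≡ k * ∑size a g
  ∑size-*ˡ k g = trans (∑-cong (termsUpTo a m) (λ t → x*[y*z]≡y*[x*z] (𝟙 (size t ≡ᵇ a)) k (g t))) (∑-*ˡ (termsUpTo a m) k _)

  ∑size-*ʳ : ∀ (g : Term m → ℕ) k → ∑size a (λ t → g t * k) ≡ ∑size a g * k
  ∑size-*ʳ g k = trans (∑size-cong (λ t → *-comm (g t) k)) (trans (∑size-*ˡ k g) (*-comm k _))

  ∑size-conv : ∀ n (F : Term m → ℕ → ℕ → ℕ) → ∑size a (λ t → conv n (F t)) ≡ conv n (λ i j → ∑size a (λ t → F t i j))
  ∑size-conv n F = trans (∑-cong (termsUpTo a m) (λ t → sym (conv-*ˡ n (𝟙 (size t ≡ᵇ a)) (F t))))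
                         (∑-conv (termsUpTo a m) n (λ t i j → 𝟙 (size t ≡ᵇ a) * F t i j))

∑size-swap : ∀ {m m′} a b (F : Term m → Term m′ → ℕ) →
  ∑size a (λ t → ∑size b (F t)) ≡ ∑size b (λ u → ∑size a (λ t → F t u))
∑size-swap {m} {m′} a b F = begin
  ∑size a (λ t → ∑size b (F t))
    ≡⟨ ∑-cong (termsUpTo a m) (λ t → sym (∑-*ˡ (termsUpTo b m′) (𝟙 (size t ≡ᵇ a)) _)) ⟩
  ∑depth≤ a (λ t → ∑depth≤ b (λ u → 𝟙 (size t ≡ᵇ a) * (𝟙 (size u ≡ᵇ b) * F t u)))
    ≡⟨ ∑-cong (termsUpTo a m) (λ t → ∑-cong (termsUpTo b m′) (λ u →
         x*[y*z]≡y*[x*z] (𝟙 (size t ≡ᵇ a)) (𝟙 (size u ≡ᵇ b)) (F t u))) ⟩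
  ∑depth≤ a (λ t → ∑depth≤ b (λ u → 𝟙 (size u ≡ᵇ b) * (𝟙 (size t ≡ᵇ a) * F t u)))
    ≡⟨ ∑-swap (termsUpTo a m) (termsUpTo b m′) _ ⟩
  ∑depth≤ b (λ u → ∑depth≤ a (λ t → 𝟙 (size u ≡ᵇ b) * (𝟙 (size t ≡ᵇ a) * F t u)))
    ≡⟨ ∑-cong (termsUpTo b m′) (λ u → ∑-*ˡ (termsUpTo a m) (𝟙 (size u ≡ᵇ b)) _) ⟩
  ∑size b (λ u → ∑size a (λ t → F t u)) ∎

∑depth≤-split-size : ∀ a {m} (G : Term m → Term m → ℕ) →
  ∑depth≤ a (λ t → ∑depth≤ a (λ u → 𝟙 (size t + size u ≡ᵇ a) * G t u)) ≡ conv a (λ i j → ∑size i (λ t → ∑size j (G t)))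
∑depth≤-split-size a {m} G = begin
  ∑depth≤ a (λ t → ∑depth≤ a (λ u → 𝟙 (size t + size u ≡ᵇ a) * G t u))
    ≡⟨ ∑-cong L (λ t → ∑-cong L (λ u → trans (cong (_* G t u) (𝟙[m+n≡ᵇa]≡conv a (size t) (size u))) (conv-*ʳ t u))) ⟩
  ∑depth≤ a (λ t → ∑depth≤ a (λ u → conv a (λ i j → H i j t u)))
    ≡⟨ ∑-cong L (λ t → ∑-conv L a (λ u i j → H i j t u)) ⟩
  ∑depth≤ a (λ t → conv a (λ i j → ∑depth≤ a (H i j t)))
    ≡⟨ ∑-conv L a (λ t i j → ∑depth≤ a (H i j t)) ⟩
  conv a (λ i j → ∑depth≤ a (λ t → ∑depth≤ a (H i j t)))
    ≡⟨ conv-cong a (λ i i≤a → restrict i (a ∸ i) i≤a (m∸n≤m a i)) ⟩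
  conv a (λ i j → ∑size i (λ t → ∑size j (G t))) ∎
  where
  L = termsUpTo a m
  H : ℕ → ℕ → Term m → Term m → ℕ
  H i j t u = 𝟙 (size t ≡ᵇ i) * (𝟙 (size u ≡ᵇ j) * G t u)
  conv-*ʳ : ∀ t u → conv a (λ i j → 𝟙 (size t ≡ᵇ i) * 𝟙 (size u ≡ᵇ j)) * G t u ≡ conv a (λ i j → H i j t u)
  conv-*ʳ t u = trans (*-comm _ (G t u)) (trans (sym (conv-*ˡ a (G t u) _))
                      (conv-cong a (λ i _ → trans (*-comm (G t u) _) (*-assoc (𝟙 (size t ≡ᵇ i)) _ _))))
  restrict : ∀ i j → i ≤ a → j ≤ a → ∑depth≤ a (λ t → ∑depth≤ a (H i j t)) ≡ ∑size i (λ t → ∑size j (G t))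
  restrict i j i≤a j≤a = begin
    ∑depth≤ a (λ t → ∑depth≤ a (H i j t))
      ≡⟨ ∑-cong L (λ t → ∑-*ˡ L (𝟙 (size t ≡ᵇ i)) _) ⟩
    ∑depth≤ a (λ t → 𝟙 (size t ≡ᵇ i) * ∑depth≤ a (λ u → 𝟙 (size u ≡ᵇ j) * G t u))
      ≡⟨ ∑-cong L (λ t → cong (𝟙 (size t ≡ᵇ i) *_) (∑size-depth j a (G t) j≤a)) ⟩
    ∑depth≤ a (λ t → 𝟙 (size t ≡ᵇ i) * ∑size j (G t))
      ≡⟨ ∑size-depth i a _ i≤a ⟩
    ∑size i (λ t → ∑size j (G t)) ∎

∑size-suc : ∀ a {m} (g : Term m → ℕ) → ∑size (suc a) g ≡
  𝟙 (0 ≡ᵇ a) * ∑ (allFin m) (g ∘ var) + (conv a (λ i j → ∑size i (λ t → ∑size j (λ u → g (app t u)))) + ∑size a (g ∘ lam))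
∑size-suc a {m} g = trans (∑depth≤-suc a (λ t → 𝟙 (size t ≡ᵇ suc a) * g t))
  (cong₂ _+_ (∑-*ˡ (allFin m) (𝟙 (0 ≡ᵇ a)) (g ∘ var))
             (cong (_+ ∑size a (g ∘ lam)) (∑depth≤-split-size a (λ t u → g (app t u)))))

-- The fresh variable is the highest index fromℕ m rather than zero, so binders leave it
-- untouched and weakening commutes with λ.
weaken : ∀ {m} → Term m → Term (suc m)
weaken (var i)   = var (inject₁ i)
weaken (app t u) = app (weaken t) (weaken u)
weaken (lam t)   = lam (weaken t)

occ-var : ∀ {m} (i j : Fin m) → occ i (var j) ≡ 𝟙 (eqFin i j)
occ-var i j with eqFin i j
... | true  = refl
... | false = refl

eqFin-inject₁ : ∀ {m} (i j : Fin m) → eqFin (inject₁ i) (inject₁ j) ≡ eqFin i j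
eqFin-inject₁ zero    zero    = refl
eqFin-inject₁ zero    (suc j) = refl
eqFin-inject₁ (suc i) zero    = refl
eqFin-inject₁ (suc i) (suc j) = eqFin-inject₁ i j

eqFin-inject₁-fromℕ : ∀ {m} (i : Fin m) → eqFin (inject₁ i) (fromℕ m) ≡ false
eqFin-inject₁-fromℕ zero    = refl
eqFin-inject₁-fromℕ (suc i) = eqFin-inject₁-fromℕ i

occ-weaken : ∀ {m} (i : Fin m) (t : Term m) → occ (inject₁ i) (weaken t) ≡ occ i t
occ-weaken i (var j)   = trans (occ-var (inject₁ i) (inject₁ j)) (trans (cong 𝟙 (eqFin-inject₁ i j)) (sym (occ-var i j)))
occ-weaken i (app t u) = cong₂ _+_ (occ-weaken i t) (occ-weaken i u)
occ-weaken i (lam t)   = occ-weaken (suc i) t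

isLinear-weaken : ∀ {m} (t : Term m) → isLinear (weaken t) ≡ isLinear t
isLinear-weaken (var _)   = refl
isLinear-weaken (app t u) = cong₂ _∧_ (isLinear-weaken t) (isLinear-weaken u)
isLinear-weaken (lam t)   = cong₂ (λ b n → b ∧ (n ≡ᵇ 1)) (isLinear-weaken t) (occ-weaken zero t)

idCount-weaken : ∀ {m} (t : Term m) → idCount (weaken t) ≡ idCount t
idCount-weaken (var _)             = refl
idCount-weaken (app t u)           = cong₂ _+_ (idCount-weaken t) (idCount-weaken u)
idCount-weaken (lam (var zero))    = refl
idCount-weaken (lam (var (suc _))) = refl
idCount-weaken (lam (app t u))     = idCount-weaken (app t u)
idCount-weaken (lam (lam t))       = idCount-weaken (lam t)

freshIfIdentityBody : ∀ {m} → Term (suc m) → List (Term (suc m))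
freshIfIdentityBody {m} (var zero) = var (fromℕ m) ∷ []
freshIfIdentityBody (var (suc _))  = []
freshIfIdentityBody (app _ _)      = []
freshIfIdentityBody (lam _)        = []

replaceOneIdentity : ∀ {m} → Term m → List (Term (suc m))
replaceOneIdentity (var _)   = []
replaceOneIdentity (app t u) = map (λ s → app s (weaken u)) (replaceOneIdentity t) ++ map (app (weaken t)) (replaceOneIdentity u)
replaceOneIdentity (lam t)   = freshIfIdentityBody t ++ map lam (replaceOneIdentity t)

length-replaceOneIdentity : ∀ {m} (t : Term m) → length (replaceOneIdentity t) ≡ idCount t
length-replaceOneIdentity (var _) = refl
length-replaceOneIdentity (app t u) = begin
  length (map _ (replaceOneIdentity t) ++ map _ (replaceOneIdentity u))
    ≡⟨ length-++ (map _ (replaceOneIdentity t)) ⟩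
  length (map _ (replaceOneIdentity t)) + length (map _ (replaceOneIdentity u))
    ≡⟨ cong₂ _+_ (length-map _ (replaceOneIdentity t)) (length-map _ (replaceOneIdentity u)) ⟩
  length (replaceOneIdentity t) + length (replaceOneIdentity u)
    ≡⟨ cong₂ _+_ (length-replaceOneIdentity t) (length-replaceOneIdentity u) ⟩
  idCount t + idCount u ∎
length-replaceOneIdentity (lam (var zero))    = refl
length-replaceOneIdentity (lam (var (suc _))) = refl
length-replaceOneIdentity (lam (app t u))     = trans (length-map lam (replaceOneIdentity (app t u))) (length-replaceOneIdentity (app t u))
length-replaceOneIdentity (lam (lam t))       = trans (length-map lam (replaceOneIdentity (lam t))) (length-replaceOneIdentity (lam t))

record IdentityReplaced {m} (s : Term (suc m)) (t : Term m) : Set where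
  field
    occ-inject₁ : ∀ i → occ (inject₁ i) s ≡ occ i t
    isLinear≡   : isLinear s ≡ isLinear t
    idCount-suc : suc (idCount s) ≡ idCount t
open IdentityReplaced

-- Neither a replacement nor (when there is one) the original body is var zero, so putting
-- either under λ does not change its number of identities.
idCount-lam-replaceOneIdentity : ∀ {m} (t : Term (suc m)) →
  All (λ s → idCount (lam s) ≡ idCount s × idCount (lam t) ≡ idCount t) (replaceOneIdentity t)
idCount-lam-replaceOneIdentity (var _)             = []
idCount-lam-replaceOneIdentity (app t u)           =
  ++⁺ (map⁺ (universal (λ _ → refl , refl) (replaceOneIdentity t))) (map⁺ (universal (λ _ → refl , refl) (replaceOneIdentity u)))
idCount-lam-replaceOneIdentity (lam (var zero))    = (refl , refl) ∷ []
idCount-lam-replaceOneIdentity (lam (var (suc _))) = []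
idCount-lam-replaceOneIdentity (lam (app t u))     = map⁺ (universal (λ _ → refl , refl) (replaceOneIdentity (app t u)))
idCount-lam-replaceOneIdentity (lam (lam t))       = map⁺ (universal (λ _ → refl , refl) (replaceOneIdentity (lam t)))

replaceOneIdentity-replaces : ∀ {m} (t : Term m) → All (λ s → IdentityReplaced s t) (replaceOneIdentity t)
replaceOneIdentity-replaces (var _)   = []
replaceOneIdentity-replaces (app t u) =
  ++⁺ (map⁺ (All.map inLeft (replaceOneIdentity-replaces t))) (map⁺ (All.map inRight (replaceOneIdentity-replaces u)))
  where
  inLeft : ∀ {s} → IdentityReplaced s t → IdentityReplaced (app s (weaken u)) (app t u)
  inLeft r = record
    { occ-inject₁ = λ i → cong₂ _+_ (occ-inject₁ r i) (occ-weaken i u)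
    ; isLinear≡   = cong₂ _∧_ (isLinear≡ r) (isLinear-weaken u)
    ; idCount-suc = cong₂ _+_ (idCount-suc r) (idCount-weaken u)
    }
  inRight : ∀ {s} → IdentityReplaced s u → IdentityReplaced (app (weaken t) s) (app t u)
  inRight {s} r = record
    { occ-inject₁ = λ i → cong₂ _+_ (occ-weaken i t) (occ-inject₁ r i)
    ; isLinear≡   = cong₂ _∧_ (isLinear-weaken t) (isLinear≡ r)
    ; idCount-suc = trans (sym (+-suc (idCount (weaken t)) (idCount s))) (cong₂ _+_ (idCount-weaken t) (idCount-suc r))
    }
replaceOneIdentity-replaces {m} (lam t) =
  ++⁺ (atRoot t) (map⁺ (All.zipWith underLam (replaceOneIdentity-replaces t , idCount-lam-replaceOneIdentity t)))
  where
  atRoot : ∀ t → All (λ s → IdentityReplaced s (lam t)) (freshIfIdentityBody t)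
  atRoot (var zero) = record
    { occ-inject₁ = λ i → trans (occ-var (inject₁ i) (fromℕ m)) (cong 𝟙 (eqFin-inject₁-fromℕ i))
    ; isLinear≡   = refl
    ; idCount-suc = refl
    } ∷ []
  atRoot (var (suc _)) = []
  atRoot (app _ _)     = []
  atRoot (lam _)       = []
  underLam : ∀ {s} → IdentityReplaced s t × (idCount (lam s) ≡ idCount s × idCount (lam t) ≡ idCount t) →
             IdentityReplaced (lam s) (lam t)
  underLam (r , lamS , lamT) = record
    { occ-inject₁ = λ i → occ-inject₁ r (suc i)
    ; isLinear≡   = cong₂ (λ b n → b ∧ (n ≡ᵇ 1)) (isLinear≡ r) (occ-inject₁ r zero)
    ; idCount-suc = trans (cong suc lamS) (trans (idCount-suc r) (sym lamT))
    }

linearWithIds : ℕ → ∀ {m} → Term m → ℕ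
linearWithIds k t = 𝟙 (isLinear t) * 𝟙 (idCount t ≡ᵇ k)

∑-replaceOneIdentity : ∀ {m} (t : Term m) k → ∑ (replaceOneIdentity t) (linearWithIds k) ≡ suc k * linearWithIds (suc k) t
∑-replaceOneIdentity t k = begin
  ∑ (replaceOneIdentity t) (linearWithIds k)
    ≡⟨ ∑-const (replaceOneIdentity t) (All.map (λ r → cong₂ (λ b n → 𝟙 b * 𝟙 (n ≡ᵇ suc k)) (isLinear≡ r) (idCount-suc r))
                                               (replaceOneIdentity-replaces t)) ⟩
  length (replaceOneIdentity t) * linearWithIds (suc k) t
    ≡⟨ cong (_* linearWithIds (suc k) t) (length-replaceOneIdentity t) ⟩
  idCount t * (𝟙 (isLinear t) * 𝟙 (idCount t ≡ᵇ suc k))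
    ≡⟨ x*[y*z]≡y*[x*z] (idCount t) (𝟙 (isLinear t)) _ ⟩
  𝟙 (isLinear t) * (idCount t * 𝟙 (idCount t ≡ᵇ suc k))
    ≡⟨ cong (𝟙 (isLinear t) *_) (m*𝟙[m≡ᵇn]≡n*𝟙[m≡ᵇn] (idCount t) (suc k)) ⟩
  𝟙 (isLinear t) * (suc k * 𝟙 (idCount t ≡ᵇ suc k))
    ≡⟨ x*[y*z]≡y*[x*z] (𝟙 (isLinear t)) (suc k) _ ⟩
  suc k * linearWithIds (suc k) t ∎

absentFrom : ∀ {m} → Fin m → Term m → ℕ
absentFrom i s = 𝟙 (occ i s ≡ᵇ 0)

onceIn : ∀ {m} → Fin m → Term m → ℕ
onceIn i s = 𝟙 (occ i s ≡ᵇ 1)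

∑-allFin-≢fromℕ : ∀ m (f : Fin (suc m) → ℕ) →
  ∑ (allFin (suc m)) (λ i → 𝟙 (𝟙 (eqFin (fromℕ m) i) ≡ᵇ 0) * f i) ≡ ∑ (allFin m) (f ∘ inject₁)
∑-allFin-≢fromℕ zero    f = refl
∑-allFin-≢fromℕ (suc m) f = begin
  ∑ (allFin (suc (suc m))) (λ i → 𝟙 (𝟙 (eqFin (fromℕ (suc m)) i) ≡ᵇ 0) * f i)
    ≡⟨ ∑-allFin-suc (suc m) (λ i → 𝟙 (𝟙 (eqFin (fromℕ (suc m)) i) ≡ᵇ 0) * f i) ⟩
  f zero + 0 + ∑ (allFin (suc m)) (λ i → 𝟙 (𝟙 (eqFin (fromℕ m) i) ≡ᵇ 0) * f (suc i))
    ≡⟨ cong₂ _+_ (+-identityʳ (f zero)) (∑-allFin-≢fromℕ m (f ∘ suc)) ⟩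
  f zero + ∑ (allFin m) (f ∘ suc ∘ inject₁)
    ≡⟨ sym (∑-allFin-suc m (f ∘ inject₁)) ⟩
  ∑ (allFin (suc m)) (f ∘ inject₁) ∎

∑-allFin-≡fromℕ : ∀ m (f : Fin (suc m) → ℕ) →
  ∑ (allFin (suc m)) (λ i → 𝟙 (𝟙 (eqFin (fromℕ m) i) ≡ᵇ 1) * f i) ≡ f (fromℕ m)
∑-allFin-≡fromℕ zero    f = trans (+-identityʳ _) (+-identityʳ (f zero))
∑-allFin-≡fromℕ (suc m) f =
  trans (∑-allFin-suc (suc m) (λ i → 𝟙 (𝟙 (eqFin (fromℕ (suc m)) i) ≡ᵇ 1) * f i)) (∑-allFin-≡fromℕ m (f ∘ suc))

private
  WeakeningSum : ℕ → Set
  WeakeningSum c = ∀ {m} (h : Term (suc m) → ℕ) → ∑size c (h ∘ weaken) ≡ ∑size c (λ s → absentFrom (fromℕ m) s * h s)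

∑size-weaken : ∀ c {m} (h : Term (suc m) → ℕ) → ∑size c (h ∘ weaken) ≡ ∑size c (λ s → absentFrom (fromℕ m) s * h s)
∑size-weaken = <-rec WeakeningSum step
  where
  step : ∀ c → (∀ {i} → i < c → WeakeningSum i) → WeakeningSum c
  step zero    _  h = refl
  step (suc c) ih {m} h = begin
    ∑size (suc c) (h ∘ weaken)  ≡⟨ ∑size-suc c (h ∘ weaken) ⟩
    _                           ≡⟨ cong₂ _+_ (cong (𝟙 (0 ≡ᵇ c) *_) vars) (cong₂ _+_ apps lams) ⟩
    _                           ≡⟨ sym (∑size-suc c H) ⟩
    ∑size (suc c) H             ∎
    where
    H : Term (suc m) → ℕ
    H s = absentFrom (fromℕ m) s * h s
    vars : ∑ (allFin m) (h ∘ var ∘ inject₁) ≡ ∑ (allFin (suc m)) (H ∘ var)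
    vars = sym (trans (∑-cong (allFin (suc m)) (λ i → cong (λ n → 𝟙 (n ≡ᵇ 0) * h (var i)) (occ-var (fromℕ m) i)))
                      (∑-allFin-≢fromℕ m (h ∘ var)))
    lams : ∑size c (h ∘ lam ∘ weaken) ≡ ∑size c (H ∘ lam)
    lams = ih ≤-refl (h ∘ lam)
    splitApp : ∀ i j → i ≤ c → j ≤ c →
      ∑size i (λ t → ∑size j (λ u → h (app (weaken t) (weaken u)))) ≡ ∑size i (λ s₁ → ∑size j (λ s₂ → H (app s₁ s₂)))
    splitApp i j i≤c j≤c = begin
      ∑size i (λ t → ∑size j (λ u → h (app (weaken t) (weaken u))))
        ≡⟨ ∑size-cong i (λ t → ih (s≤s j≤c) (λ s₂ → h (app (weaken t) s₂))) ⟩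
      ∑size i (λ t → ∑size j (λ s₂ → absentFrom (fromℕ m) s₂ * h (app (weaken t) s₂)))
        ≡⟨ ih (s≤s i≤c) (λ s₁ → ∑size j (λ s₂ → absentFrom (fromℕ m) s₂ * h (app s₁ s₂))) ⟩
      ∑size i (λ s₁ → absentFrom (fromℕ m) s₁ * ∑size j (λ s₂ → absentFrom (fromℕ m) s₂ * h (app s₁ s₂)))
        ≡⟨ ∑size-cong i (λ s₁ → sym (∑size-*ˡ j (absentFrom (fromℕ m) s₁) _)) ⟩
      ∑size i (λ s₁ → ∑size j (λ s₂ → absentFrom (fromℕ m) s₁ * (absentFrom (fromℕ m) s₂ * h (app s₁ s₂))))
        ≡⟨ ∑size-cong i (λ s₁ → ∑size-cong j (λ s₂ → trans (sym (*-assoc (absentFrom (fromℕ m) s₁) _ _))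
                                                           (cong (_* h (app s₁ s₂)) (sym (𝟙[m+n≡ᵇ0] (occ (fromℕ m) s₁) _))))) ⟩
      ∑size i (λ s₁ → ∑size j (λ s₂ → H (app s₁ s₂))) ∎
    apps : conv c (λ i j → ∑size i (λ t → ∑size j (λ u → h (app (weaken t) (weaken u)))))
         ≡ conv c (λ i j → ∑size i (λ s₁ → ∑size j (λ s₂ → H (app s₁ s₂))))
    apps = conv-cong c (λ i i≤c → splitApp i (c ∸ i) i≤c (m∸n≤m c i))

0≡ᵇn≡n≡ᵇ0 : ∀ n → (0 ≡ᵇ n) ≡ (n ≡ᵇ 0)
0≡ᵇn≡n≡ᵇ0 zero    = refl
0≡ᵇn≡n≡ᵇ0 (suc n) = refl

∑size-freshIfIdentityBody : ∀ a {m} (g : Term (suc m) → ℕ) →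
  ∑size a (λ t → ∑ (freshIfIdentityBody t) g) ≡ 𝟙 (a ≡ᵇ 1) * g (var (fromℕ m))
∑size-freshIfIdentityBody zero    g = refl
∑size-freshIfIdentityBody (suc a) {m} g = begin
  ∑size (suc a) (λ t → ∑ (freshIfIdentityBody t) g)
    ≡⟨ ∑size-suc a (λ t → ∑ (freshIfIdentityBody t) g) ⟩
  𝟙 (0 ≡ᵇ a) * ∑ (allFin (suc m)) (λ i → ∑ (freshIfIdentityBody (var i)) g) + (conv a _ + ∑size {suc (suc m)} a (λ _ → 0))
    ≡⟨ cong₂ _+_ (cong₂ (λ b x → 𝟙 b * x) (0≡ᵇn≡n≡ᵇ0 a) onlyZero)
                 (cong₂ _+_ (conv-zero a (λ i j → ∑size-zero i (λ t → ∑size-zero j (λ _ → refl)))) (∑size-zero a (λ _ → refl))) ⟩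
  𝟙 (a ≡ᵇ 0) * g (var (fromℕ m)) + 0
    ≡⟨ +-identityʳ _ ⟩
  𝟙 (suc a ≡ᵇ 1) * g (var (fromℕ m)) ∎
  where
  onlyZero : ∑ (allFin (suc m)) (λ i → ∑ (freshIfIdentityBody (var i)) g) ≡ g (var (fromℕ m))
  onlyZero = trans (∑-allFin-suc m (λ i → ∑ (freshIfIdentityBody (var i)) g))
                   (trans (cong₂ _+_ (+-identityʳ _) (∑-zero (allFin m) (λ _ → refl))) (+-identityʳ _))

ReplacementSum : ℕ → Set
ReplacementSum n = ∀ {m} (g : Term (suc m) → ℕ) →
  ∑size (suc n) (λ t → ∑ (replaceOneIdentity t) g) ≡ ∑size n (λ s → onceIn (fromℕ m) s * g s)

∑size-replaceOneIdentity-lam : ∀ n → ReplacementSum n → ∀ {m} (g : Term (suc m) → ℕ) →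
  ∑size (suc n) (λ t → ∑ (replaceOneIdentity (lam t)) g) ≡
  𝟙 (0 ≡ᵇ n) * g (var (fromℕ m)) + ∑size n (λ s → onceIn (fromℕ (suc m)) s * g (lam s))
∑size-replaceOneIdentity-lam n ih {m} g = begin
  ∑size (suc n) (λ t → ∑ (freshIfIdentityBody t ++ map lam (replaceOneIdentity t)) g)
    ≡⟨ ∑size-cong (suc n) (λ t → trans (∑-++ (freshIfIdentityBody t) _ g)
                                       (cong (_+_ (∑ (freshIfIdentityBody t) g)) (∑-map lam (replaceOneIdentity t) g))) ⟩
  ∑size (suc n) (λ t → ∑ (freshIfIdentityBody t) g + ∑ (replaceOneIdentity t) (g ∘ lam))
    ≡⟨ ∑size-+ (suc n) (λ t → ∑ (freshIfIdentityBody t) g) (λ t → ∑ (replaceOneIdentity t) (g ∘ lam)) ⟩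
  ∑size (suc n) (λ t → ∑ (freshIfIdentityBody t) g) + ∑size (suc n) (λ t → ∑ (replaceOneIdentity t) (g ∘ lam))
    ≡⟨ cong₂ _+_ (trans (∑size-freshIfIdentityBody (suc n) g) (cong (λ b → 𝟙 b * g (var (fromℕ m))) (sym (0≡ᵇn≡n≡ᵇ0 n))))
                 (ih (g ∘ lam)) ⟩
  𝟙 (0 ≡ᵇ n) * g (var (fromℕ m)) + ∑size n (λ s → onceIn (fromℕ (suc m)) s * g (lam s)) ∎

module _ (n : ℕ) (ih : ∀ {i} → i ≤ n → ReplacementSum i) {m : ℕ} (g : Term (suc m) → ℕ) where

  ∑size-replaceOneIdentity-appˡ :
    conv (suc n) (λ a b → ∑size a (λ t → ∑size b (λ u → ∑ (replaceOneIdentity t) (λ s → g (app s (weaken u))))))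
    ≡ conv n (λ i j → ∑size i (λ s₁ → ∑size j (λ s₂ → onceIn (fromℕ m) s₁ * (absentFrom (fromℕ m) s₂ * g (app s₁ s₂)))))
  ∑size-replaceOneIdentity-appˡ = trans (conv-suc n F) (conv-cong n step)
    where
    F : ℕ → ℕ → ℕ
    F a b = ∑size a (λ t → ∑size b (λ u → ∑ (replaceOneIdentity t) (λ s → g (app s (weaken u)))))
    step : ∀ i → i ≤ n →
      ∑size (suc i) (λ t → ∑size (n ∸ i) (λ u → ∑ (replaceOneIdentity t) (λ s → g (app s (weaken u))))) ≡
      ∑size i (λ s₁ → ∑size (n ∸ i) (λ s₂ → onceIn (fromℕ m) s₁ * (absentFrom (fromℕ m) s₂ * g (app s₁ s₂))))
    step i i≤n = begin
      ∑size (suc i) (λ t → ∑size j (λ u → ∑ (replaceOneIdentity t) (λ s → g (app s (weaken u)))))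
        ≡⟨ ∑size-swap (suc i) j (λ t u → ∑ (replaceOneIdentity t) (λ s → g (app s (weaken u)))) ⟩
      ∑size j (λ u → ∑size (suc i) (λ t → ∑ (replaceOneIdentity t) (λ s → g (app s (weaken u)))))
        ≡⟨ ∑size-cong j (λ u → ih i≤n (λ s → g (app s (weaken u)))) ⟩
      ∑size j (λ u → ∑size i (λ s₁ → onceIn (fromℕ m) s₁ * g (app s₁ (weaken u))))
        ≡⟨ ∑size-swap j i (λ u s₁ → onceIn (fromℕ m) s₁ * g (app s₁ (weaken u))) ⟩
      ∑size i (λ s₁ → ∑size j (λ u → onceIn (fromℕ m) s₁ * g (app s₁ (weaken u))))
        ≡⟨ ∑size-cong i (λ s₁ → ∑size-weaken j (λ s₂ → onceIn (fromℕ m) s₁ * g (app s₁ s₂))) ⟩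
      ∑size i (λ s₁ → ∑size j (λ s₂ → absentFrom (fromℕ m) s₂ * (onceIn (fromℕ m) s₁ * g (app s₁ s₂))))
        ≡⟨ ∑size-cong i (λ s₁ → ∑size-cong j (λ s₂ →
             x*[y*z]≡y*[x*z] (absentFrom (fromℕ m) s₂) (onceIn (fromℕ m) s₁) (g (app s₁ s₂)))) ⟩
      ∑size i (λ s₁ → ∑size j (λ s₂ → onceIn (fromℕ m) s₁ * (absentFrom (fromℕ m) s₂ * g (app s₁ s₂)))) ∎
      where j = n ∸ i

  ∑size-replaceOneIdentity-appʳ :
    conv (suc n) (λ a b → ∑size a (λ t → ∑size b (λ u → ∑ (replaceOneIdentity u) (λ s → g (app (weaken t) s)))))
    ≡ conv n (λ i j → ∑size i (λ s₁ → ∑size j (λ s₂ → absentFrom (fromℕ m) s₁ * (onceIn (fromℕ m) s₂ * g (app s₁ s₂)))))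
  ∑size-replaceOneIdentity-appʳ = begin
    conv (suc n) F                               ≡⟨ conv-sucʳ n F ⟩
    conv n (λ i j → F i (suc j)) + F (suc n) 0   ≡⟨ cong (_+_ (conv n (λ i j → F i (suc j)))) (∑size-zero {m} (suc n) (λ _ → refl)) ⟩
    conv n (λ i j → F i (suc j)) + 0             ≡⟨ +-identityʳ _ ⟩
    conv n (λ i j → F i (suc j))                 ≡⟨ conv-cong n step ⟩
    _                                            ∎
    where
    F : ℕ → ℕ → ℕ
    F a b = ∑size a (λ t → ∑size b (λ u → ∑ (replaceOneIdentity u) (λ s → g (app (weaken t) s))))
    step : ∀ i → i ≤ n →
      ∑size i (λ t → ∑size (suc (n ∸ i)) (λ u → ∑ (replaceOneIdentity u) (λ s → g (app (weaken t) s)))) ≡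
      ∑size i (λ s₁ → ∑size (n ∸ i) (λ s₂ → absentFrom (fromℕ m) s₁ * (onceIn (fromℕ m) s₂ * g (app s₁ s₂))))
    step i _ = begin
      ∑size i (λ t → ∑size (suc j) (λ u → ∑ (replaceOneIdentity u) (λ s → g (app (weaken t) s))))
        ≡⟨ ∑size-cong i (λ t → ih (m∸n≤m n i) (λ s → g (app (weaken t) s))) ⟩
      ∑size i (λ t → ∑size j (λ s₂ → onceIn (fromℕ m) s₂ * g (app (weaken t) s₂)))
        ≡⟨ ∑size-weaken i (λ s₁ → ∑size j (λ s₂ → onceIn (fromℕ m) s₂ * g (app s₁ s₂))) ⟩
      ∑size i (λ s₁ → absentFrom (fromℕ m) s₁ * ∑size j (λ s₂ → onceIn (fromℕ m) s₂ * g (app s₁ s₂)))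
        ≡⟨ ∑size-cong i (λ s₁ → sym (∑size-*ˡ j (absentFrom (fromℕ m) s₁) _)) ⟩
      ∑size i (λ s₁ → ∑size j (λ s₂ → absentFrom (fromℕ m) s₁ * (onceIn (fromℕ m) s₂ * g (app s₁ s₂)))) ∎
      where j = n ∸ i

∑size-replaceOneIdentity-app : ∀ n → (∀ {i} → i ≤ n → ReplacementSum i) → ∀ {m} (g : Term (suc m) → ℕ) →
  conv (suc n) (λ a b → ∑size a (λ t → ∑size b (λ u → ∑ (replaceOneIdentity (app t u)) g)))
  ≡ conv n (λ i j → ∑size i (λ s₁ → ∑size j (λ s₂ → onceIn (fromℕ m) (app s₁ s₂) * g (app s₁ s₂))))
∑size-replaceOneIdentity-app n ih {m} g = begin
  conv (suc n) (λ a b → ∑size a (λ t → ∑size b (λ u → ∑ (replaceOneIdentity (app t u)) g)))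
    ≡⟨ conv-cong (suc n) (λ a _ → trans (∑size-cong a (λ t → ∑size-cong (suc n ∸ a) (split t))) (∑size²-+ a (suc n ∸ a) _ _)) ⟩
  conv (suc n) (λ a b → idLeft a b + idRight a b)
    ≡⟨ conv-+ (suc n) idLeft idRight ⟩
  conv (suc n) idLeft + conv (suc n) idRight
    ≡⟨ cong₂ _+_ (∑size-replaceOneIdentity-appˡ n ih g) (∑size-replaceOneIdentity-appʳ n ih g) ⟩
  conv n onceLeft + conv n onceRight
    ≡⟨ sym (conv-+ n onceLeft onceRight) ⟩
  conv n (λ i j → onceLeft i j + onceRight i j)
    ≡⟨ conv-cong n (λ i _ → trans (sym (∑size²-+ i (n ∸ i) _ _)) (∑size-cong i (λ s₁ → ∑size-cong (n ∸ i) (onceIn-app s₁)))) ⟩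
  conv n (λ i j → ∑size i (λ s₁ → ∑size j (λ s₂ → onceIn fresh (app s₁ s₂) * g (app s₁ s₂)))) ∎
  where
  fresh = fromℕ m
  inLeft inRight : Term m → Term m → ℕ
  inLeft  t u = ∑ (replaceOneIdentity t) (λ s → g (app s (weaken u)))
  inRight t u = ∑ (replaceOneIdentity u) (λ s → g (app (weaken t) s))
  idLeft idRight onceLeft onceRight : ℕ → ℕ → ℕ
  idLeft  a b = ∑size a (λ t → ∑size b (inLeft t))
  idRight a b = ∑size a (λ t → ∑size b (inRight t))
  onceLeft  i j = ∑size i (λ s₁ → ∑size j (λ s₂ → onceIn fresh s₁ * (absentFrom fresh s₂ * g (app s₁ s₂))))
  onceRight i j = ∑size i (λ s₁ → ∑size j (λ s₂ → absentFrom fresh s₁ * (onceIn fresh s₂ * g (app s₁ s₂))))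
  split : ∀ t u → ∑ (replaceOneIdentity (app t u)) g ≡ inLeft t u + inRight t u
  split t u = trans (∑-++ (map _ (replaceOneIdentity t)) _ g)
                    (cong₂ _+_ (∑-map (λ s → app s (weaken u)) (replaceOneIdentity t) g) (∑-map (app (weaken t)) (replaceOneIdentity u) g))
  ∑size²-+ : ∀ {m′} a b (F G : Term m′ → Term m′ → ℕ) →
    ∑size a (λ t → ∑size b (λ u → F t u + G t u)) ≡ ∑size a (λ t → ∑size b (F t)) + ∑size a (λ t → ∑size b (G t))
  ∑size²-+ a b F G = trans (∑size-cong a (λ t → ∑size-+ b (F t) (G t))) (∑size-+ a _ _)
  distrib : ∀ a b c d x → (a * b + c * d) * x ≡ a * (b * x) + c * (d * x)
  distrib = solve-∀
  onceIn-app : ∀ s₁ s₂ →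
    onceIn fresh s₁ * (absentFrom fresh s₂ * g (app s₁ s₂)) + absentFrom fresh s₁ * (onceIn fresh s₂ * g (app s₁ s₂))
    ≡ onceIn fresh (app s₁ s₂) * g (app s₁ s₂)
  onceIn-app s₁ s₂ = sym (trans (cong (_* g (app s₁ s₂)) (𝟙[m+n≡ᵇ1] (occ fresh s₁) (occ fresh s₂)))
                                (distrib (onceIn fresh s₁) (absentFrom fresh s₂) (absentFrom fresh s₁) (onceIn fresh s₂) (g (app s₁ s₂))))

ReplacementSum-suc : ∀ n → (∀ {i} → i ≤ n → ReplacementSum i) → ReplacementSum (suc n)
ReplacementSum-suc n ih {m} g = begin
  ∑size (suc (suc n)) G
    ≡⟨ ∑size-suc (suc n) G ⟩
  conv (suc n) (λ a b → ∑size a (λ t → ∑size b (λ u → G (app t u)))) + ∑size (suc n) (G ∘ lam)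
    ≡⟨ cong₂ _+_ (∑size-replaceOneIdentity-app n ih g) (∑size-replaceOneIdentity-lam n (ih ≤-refl) g) ⟩
  apps + (𝟙 (0 ≡ᵇ n) * g (var (fromℕ m)) + lams)
    ≡⟨ x+[y+z]≡y+[x+z] apps _ lams ⟩
  𝟙 (0 ≡ᵇ n) * g (var (fromℕ m)) + (apps + lams)
    ≡⟨ cong (λ x → 𝟙 (0 ≡ᵇ n) * x + (apps + lams)) (sym vars) ⟩
  𝟙 (0 ≡ᵇ n) * ∑ (allFin (suc m)) (H ∘ var) + (apps + lams)
    ≡⟨ sym (∑size-suc n H) ⟩
  ∑size (suc n) H ∎
  where
  G : Term m → ℕ
  G t = ∑ (replaceOneIdentity t) g
  H : Term (suc m) → ℕ
  H s = onceIn (fromℕ m) s * g s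
  apps = conv n (λ i j → ∑size i (λ s₁ → ∑size j (λ s₂ → H (app s₁ s₂))))
  lams = ∑size n (H ∘ lam)
  x+[y+z]≡y+[x+z] : ∀ x y z → x + (y + z) ≡ y + (x + z)
  x+[y+z]≡y+[x+z] = solve-∀
  vars : ∑ (allFin (suc m)) (H ∘ var) ≡ g (var (fromℕ m))
  vars = trans (∑-cong (allFin (suc m)) (λ i → cong (λ x → 𝟙 (x ≡ᵇ 1) * g (var i)) (occ-var (fromℕ m) i)))
               (∑-allFin-≡fromℕ m (g ∘ var))

∑size-replaceOneIdentity : ∀ n → ReplacementSum n
∑size-replaceOneIdentity = <-rec ReplacementSum step
  where
  step : ∀ n → (∀ {i} → i < n → ReplacementSum i) → ReplacementSum n
  step zero    _  {m} g = trans (∑size-suc 0 (λ t → ∑ (replaceOneIdentity t) g))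
                               (cong₂ (λ x y → 1 * x + (y + 0)) (∑-zero (allFin m) (λ _ → refl)) (conv-0 _))
  step (suc n) ih g = ReplacementSum-suc n (λ i≤n → ih (s≤s i≤n)) g

linearCount : ℕ → ℕ → ℕ
linearCount n k = ∑size {0} n (linearWithIds k)

linearCount² : ℕ → ℕ → ℕ
linearCount² a k = conv a (λ i j → conv k (λ k₁ k₂ → linearCount i k₁ * linearCount j k₂))

countTid≡linearCount : ∀ n k → countTid n k ≡ linearCount n k
countTid≡linearCount n k =
  trans (length-filter≡∑𝟙 (λ t → isLinear t ∧ (size t ≡ᵇ n) ∧ (idCount t ≡ᵇ k)) (termsUpTo n 0))
        (∑-cong (termsUpTo n 0) reorder)
  where
  reorder : ∀ t → 𝟙 (isLinear t ∧ (size t ≡ᵇ n) ∧ (idCount t ≡ᵇ k)) ≡ 𝟙 (size t ≡ᵇ n) * linearWithIds k t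
  reorder t = trans (𝟙-∧ (isLinear t) _) (trans (cong (𝟙 (isLinear t) *_) (𝟙-∧ (size t ≡ᵇ n) _))
                                                (x*[y*z]≡y*[x*z] (𝟙 (isLinear t)) (𝟙 (size t ≡ᵇ n)) _))

linearWithIds-app : ∀ k {m} (t u : Term m) → linearWithIds k (app t u) ≡ conv k (λ i j → linearWithIds i t * linearWithIds j u)
linearWithIds-app k t u = begin
  𝟙 (isLinear t ∧ isLinear u) * 𝟙 (idCount t + idCount u ≡ᵇ k)
    ≡⟨ cong₂ _*_ (𝟙-∧ (isLinear t) (isLinear u)) (𝟙[m+n≡ᵇa]≡conv k (idCount t) (idCount u)) ⟩
  𝟙 (isLinear t) * 𝟙 (isLinear u) * conv k (λ i j → 𝟙 (idCount t ≡ᵇ i) * 𝟙 (idCount u ≡ᵇ j))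
    ≡⟨ sym (conv-*ˡ k (𝟙 (isLinear t) * 𝟙 (isLinear u)) _) ⟩
  conv k (λ i j → 𝟙 (isLinear t) * 𝟙 (isLinear u) * (𝟙 (idCount t ≡ᵇ i) * 𝟙 (idCount u ≡ᵇ j)))
    ≡⟨ conv-cong k (λ i _ → interchange (𝟙 (isLinear t)) (𝟙 (isLinear u)) (𝟙 (idCount t ≡ᵇ i)) _) ⟩
  conv k (λ i j → linearWithIds i t * linearWithIds j u) ∎
  where
  interchange : ∀ a b c d → a * b * (c * d) ≡ a * c * (b * d)
  interchange = solve-∀

∑size-app-linearWithIds : ∀ k i j →
  ∑size i (λ t → ∑size j (λ u → linearWithIds k (app t u))) ≡ conv k (λ k₁ k₂ → linearCount i k₁ * linearCount j k₂)
∑size-app-linearWithIds k i j = begin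
  ∑size i (λ t → ∑size j (λ u → linearWithIds k (app t u)))
    ≡⟨ ∑size-cong i (λ t → ∑size-cong j (linearWithIds-app k t)) ⟩
  ∑size i (λ t → ∑size j (λ u → conv k (λ k₁ k₂ → linearWithIds k₁ t * linearWithIds k₂ u)))
    ≡⟨ ∑size-cong i (λ t → ∑size-conv j k _) ⟩
  ∑size i (λ t → conv k (λ k₁ k₂ → ∑size j (λ u → linearWithIds k₁ t * linearWithIds k₂ u)))
    ≡⟨ ∑size-conv i k _ ⟩
  conv k (λ k₁ k₂ → ∑size i (λ t → ∑size j (λ u → linearWithIds k₁ t * linearWithIds k₂ u)))
    ≡⟨ conv-cong k (λ k₁ _ → trans (∑size-cong i (λ t → ∑size-*ˡ j (linearWithIds k₁ t) _)) (∑size-*ʳ i _ _)) ⟩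
  conv k (λ k₁ k₂ → linearCount i k₁ * linearCount j k₂) ∎

𝟙[a∧b]*x : ∀ a b x → 𝟙 (a ∧ b) * x ≡ 𝟙 b * (𝟙 a * x)
𝟙[a∧b]*x a b x = trans (cong (_* x) (trans (𝟙-∧ a b) (*-comm (𝟙 a) (𝟙 b)))) (*-assoc (𝟙 b) (𝟙 a) x)

-- λx.x is the only abstraction with an identity that its body lacks; the two sums over
-- freshIfIdentityBody s correct for it.
linearWithIds-lam : ∀ k (s : Term 1) →
  linearWithIds k (lam s) + ∑ (freshIfIdentityBody s) (λ _ → 𝟙 (k ≡ᵇ 0)) ≡
  onceIn zero s * linearWithIds k s + ∑ (freshIfIdentityBody s) (λ _ → 𝟙 (k ≡ᵇ 1))
linearWithIds-lam zero          (var zero) = refl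
linearWithIds-lam (suc zero)    (var zero) = refl
linearWithIds-lam (suc (suc k)) (var zero) = refl
linearWithIds-lam k (app s₁ s₂) = cong (_+ 0) (𝟙[a∧b]*x (isLinear (app s₁ s₂)) (occ zero (app s₁ s₂) ≡ᵇ 1) _)
linearWithIds-lam k (lam s)     = cong (_+ 0) (𝟙[a∧b]*x (isLinear (lam s)) (occ zero (lam s) ≡ᵇ 1) _)

∑size-lam-linearWithIds : ∀ a k →
  ∑size a (λ s → linearWithIds k (lam s)) + 𝟙 (a ≡ᵇ 1) * 𝟙 (k ≡ᵇ 0) ≡
  suc k * linearCount (suc a) (suc k) + 𝟙 (a ≡ᵇ 1) * 𝟙 (k ≡ᵇ 1)
∑size-lam-linearWithIds a k = begin
  ∑size a (λ s → linearWithIds k (lam s)) + 𝟙 (a ≡ᵇ 1) * 𝟙 (k ≡ᵇ 0)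
    ≡⟨ cong (_+_ (∑size a (λ s → linearWithIds k (lam s)))) (sym (∑size-freshIfIdentityBody a (λ _ → 𝟙 (k ≡ᵇ 0)))) ⟩
  ∑size a (λ s → linearWithIds k (lam s)) + ∑size a (λ s → ∑ (freshIfIdentityBody s) (λ _ → 𝟙 (k ≡ᵇ 0)))
    ≡⟨ sym (∑size-+ a _ _) ⟩
  ∑size a (λ s → linearWithIds k (lam s) + ∑ (freshIfIdentityBody s) (λ _ → 𝟙 (k ≡ᵇ 0)))
    ≡⟨ ∑size-cong a (linearWithIds-lam k) ⟩
  ∑size a (λ s → onceIn zero s * linearWithIds k s + ∑ (freshIfIdentityBody s) (λ _ → 𝟙 (k ≡ᵇ 1)))
    ≡⟨ ∑size-+ a _ _ ⟩
  ∑size a (λ s → onceIn zero s * linearWithIds k s) + ∑size a (λ s → ∑ (freshIfIdentityBody s) (λ _ → 𝟙 (k ≡ᵇ 1)))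
    ≡⟨ cong₂ _+_ markedIdentities (∑size-freshIfIdentityBody a (λ _ → 𝟙 (k ≡ᵇ 1))) ⟩
  suc k * linearCount (suc a) (suc k) + 𝟙 (a ≡ᵇ 1) * 𝟙 (k ≡ᵇ 1) ∎
  where
  markedIdentities : ∑size a (λ s → onceIn zero s * linearWithIds k s) ≡ suc k * linearCount (suc a) (suc k)
  markedIdentities = begin
    ∑size a (λ s → onceIn zero s * linearWithIds k s)
      ≡⟨ ∑size-replaceOneIdentity a {0} (linearWithIds k) ⟨
    ∑size {0} (suc a) (λ t → ∑ (replaceOneIdentity t) (linearWithIds k))
      ≡⟨ ∑size-cong {0} (suc a) (λ t → ∑-replaceOneIdentity t k) ⟩
    ∑size {0} (suc a) (λ t → suc k * linearWithIds (suc k) t)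
      ≡⟨ ∑size-*ˡ {0} (suc a) (suc k) (linearWithIds (suc k)) ⟩
    suc k * linearCount (suc a) (suc k) ∎

linearCount-suc : ∀ a k →
  linearCount (suc a) k + 𝟙 (a ≡ᵇ 1) * 𝟙 (k ≡ᵇ 0) ≡
  linearCount² a k + suc k * linearCount (suc a) (suc k) + 𝟙 (a ≡ᵇ 1) * 𝟙 (k ≡ᵇ 1)
linearCount-suc a k = begin
  linearCount (suc a) k + correction₀
    ≡⟨ cong (_+ correction₀) (∑size-suc a (linearWithIds k)) ⟩
  𝟙 (0 ≡ᵇ a) * 0 + (apps + lams) + correction₀
    ≡⟨ cong (λ x → x + (apps + lams) + correction₀) (*-zeroʳ (𝟙 (0 ≡ᵇ a))) ⟩
  apps + lams + correction₀
    ≡⟨ +-assoc apps lams correction₀ ⟩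
  apps + (lams + correction₀)
    ≡⟨ cong₂ _+_ (conv-cong a (λ i _ → ∑size-app-linearWithIds k i (a ∸ i))) (∑size-lam-linearWithIds a k) ⟩
  linearCount² a k + (suc k * linearCount (suc a) (suc k) + correction₁)
    ≡⟨ sym (+-assoc (linearCount² a k) _ correction₁) ⟩
  linearCount² a k + suc k * linearCount (suc a) (suc k) + correction₁ ∎
  where
  correction₀ = 𝟙 (a ≡ᵇ 1) * 𝟙 (k ≡ᵇ 0)
  correction₁ = 𝟙 (a ≡ᵇ 1) * 𝟙 (k ≡ᵇ 1)
  apps = conv a (λ i j → ∑size i (λ t → ∑size j (λ u → linearWithIds k (app t u))))
  lams = ∑size a (λ s → linearWithIds k (lam s))

sumℤ-applyUpTo-zero : ∀ (g : ℕ → ℕ) n {F : ℕ → ℤ} → (∀ i → F (g i) ≡ + 0) → sumℤ (map F (applyUpTo g n)) ≡ + 0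
sumℤ-applyUpTo-zero g zero    F∘g≗0 = refl
sumℤ-applyUpTo-zero g (suc n) F∘g≗0 = cong₂ ℤ._+_ (F∘g≗0 0) (sumℤ-applyUpTo-zero (g ∘ suc) n (F∘g≗0 ∘ suc))

sumℤ-upTo-suc : ∀ n (F : ℕ → ℤ) → sumℤ (map F (upTo (suc n))) ≡ F 0 ℤ.+ sumℤ (map (F ∘ suc) (upTo n))
sumℤ-upTo-suc n F = cong (λ xs → F 0 ℤ.+ sumℤ xs) (trans (map-applyUpTo suc F n) (sym (map-upTo (F ∘ suc) n)))

sumℤ-+ : ∀ {A : Set} (xs : List A) (F : A → ℤ) (f : A → ℕ) → (∀ x → F x ≡ + f x) → sumℤ (map F xs) ≡ + ∑ xs f
sumℤ-+ []       F f F≗f = refl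
sumℤ-+ (x ∷ xs) F f F≗f = trans (cong₂ ℤ._+_ (F≗f x) (sumℤ-+ xs F f F≗f)) (sym (ℤ.pos-+ (f x) (∑ xs f)))

infix 8 z·_
z·_ : FPS → FPS
(z· f) zero    k = + 0
(z· f) (suc n) k = f n k

⊛-congˡ : ∀ {f f′} g → f ≈ f′ → f ⊛ g ≈ f′ ⊛ g
⊛-congˡ g f≈f′ n k =
  cong sumℤ (map-cong (λ i → cong sumℤ (map-cong (λ j → cong (ℤ._* g (n ∸ i) (k ∸ j)) (f≈f′ i j)) (upTo (suc k)))) (upTo (suc n)))

Z-⊛ : ∀ f → Z ⊛ f ≈ z· f
Z-⊛ f zero    k = cong (ℤ._+ + 0) (sumℤ-applyUpTo-zero id (suc k) (λ _ → refl))
Z-⊛ f (suc n) k = begin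
  (Z ⊛ f) (suc n) k
    ≡⟨ cong₂ ℤ._+_ (sumℤ-applyUpTo-zero id (suc k) (λ _ → refl))
                   (cong₂ ℤ._+_ atOne (sumℤ-applyUpTo-zero (λ i → suc (suc i)) n (λ i → sumℤ-applyUpTo-zero id (suc k) (λ _ → refl)))) ⟩
  + 0 ℤ.+ (f n k ℤ.+ + 0)
    ≡⟨ trans (ℤ.+-identityˡ _) (ℤ.+-identityʳ (f n k)) ⟩
  f n k ∎
  where
  atOne : sumℤ (map (λ j → Z 1 j ℤ.* f n (k ∸ j)) (upTo (suc k))) ≡ f n k
  atOne = trans (cong₂ ℤ._+_ (ℤ.*-identityˡ (f n k)) (sumℤ-applyUpTo-zero suc k (λ _ → refl))) (ℤ.+-identityʳ (f n k))

-- Z (n ∸ i) (k ∸ j) picks out n ∸ i = 1, j = k; δ₁ records the first condition.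
δ₁ : ℕ → ℤ → ℤ
δ₁ 1 y = y
δ₁ _ y = + 0

sumℤ-⊛Z-inner : ∀ x k (h : ℕ → ℤ) → sumℤ (map (λ j → h j ℤ.* Z x (k ∸ j)) (upTo (suc k))) ≡ δ₁ x (h k)
sumℤ-⊛Z-inner 0             k h = sumℤ-applyUpTo-zero id (suc k) (λ j → ℤ.*-zeroʳ (h j))
sumℤ-⊛Z-inner 1             k h = onDiagonal k h
  where
  onDiagonal : ∀ k (h : ℕ → ℤ) → sumℤ (map (λ j → h j ℤ.* Z 1 (k ∸ j)) (upTo (suc k))) ≡ h k
  onDiagonal zero    h = trans (ℤ.+-identityʳ _) (ℤ.*-identityʳ (h 0))
  onDiagonal (suc k) h = begin
    sumℤ (map (λ j → h j ℤ.* Z 1 (suc k ∸ j)) (upTo (suc (suc k))))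
      ≡⟨ sumℤ-upTo-suc (suc k) (λ j → h j ℤ.* Z 1 (suc k ∸ j)) ⟩
    h 0 ℤ.* + 0 ℤ.+ sumℤ (map (λ j → h (suc j) ℤ.* Z 1 (k ∸ j)) (upTo (suc k)))
      ≡⟨ cong₂ ℤ._+_ (ℤ.*-zeroʳ (h 0)) (onDiagonal k (h ∘ suc)) ⟩
    + 0 ℤ.+ h (suc k)
      ≡⟨ ℤ.+-identityˡ (h (suc k)) ⟩
    h (suc k) ∎
sumℤ-⊛Z-inner (suc (suc x)) k h = sumℤ-applyUpTo-zero id (suc k) (λ j → ℤ.*-zeroʳ (h j))

sumℤ-δ₁ : ∀ n k (f : FPS) → sumℤ (map (λ i → δ₁ (n ∸ i) (f i k)) (upTo (suc n))) ≡ (z· f) n k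
sumℤ-δ₁ zero    k f = refl
sumℤ-δ₁ (suc n) k f = begin
  sumℤ (map (λ i → δ₁ (suc n ∸ i) (f i k)) (upTo (suc (suc n))))
    ≡⟨ sumℤ-upTo-suc (suc n) (λ i → δ₁ (suc n ∸ i) (f i k)) ⟩
  δ₁ (suc n) (f 0 k) ℤ.+ sumℤ (map (λ i → δ₁ (n ∸ i) (f (suc i) k)) (upTo (suc n)))
    ≡⟨ cong (λ x → δ₁ (suc n) (f 0 k) ℤ.+ x) (sumℤ-δ₁ n k (f ∘ suc)) ⟩
  δ₁ (suc n) (f 0 k) ℤ.+ (z· (f ∘ suc)) n k
    ≡⟨ last n ⟩
  f n k ∎
  where
  last : ∀ n → δ₁ (suc n) (f 0 k) ℤ.+ (z· (f ∘ suc)) n k ≡ f n k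
  last zero    = ℤ.+-identityʳ (f 0 k)
  last (suc n) = ℤ.+-identityˡ (f (suc n) k)

⊛-Z : ∀ f → f ⊛ Z ≈ z· f
⊛-Z f n k = trans (cong sumℤ (map-cong (λ i → sumℤ-⊛Z-inner (n ∸ i) k (f i)) (upTo (suc n)))) (sumℤ-δ₁ n k f)

z·-cong : ∀ {f g} → f ≈ g → z· f ≈ z· g
z·-cong f≈g zero    k = refl
z·-cong f≈g (suc n) k = f≈g n k

z·-⊛ : ∀ f g → z· f ⊛ g ≈ z· (f ⊛ g)
z·-⊛ f g zero    k = cong (ℤ._+ + 0) (sumℤ-applyUpTo-zero id (suc k) (λ _ → refl))
z·-⊛ f g (suc n) k = begin
  sumℤ (map column (upTo (suc (suc n))))
    ≡⟨ sumℤ-upTo-suc (suc n) column ⟩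
  column 0 ℤ.+ sumℤ (map (column ∘ suc) (upTo (suc n)))
    ≡⟨ cong (ℤ._+ sumℤ (map (column ∘ suc) (upTo (suc n)))) (sumℤ-applyUpTo-zero id (suc k) (λ _ → refl)) ⟩
  + 0 ℤ.+ (f ⊛ g) n k
    ≡⟨ ℤ.+-identityˡ _ ⟩
  (f ⊛ g) n k ∎
  where
  column : ℕ → ℤ
  column i = sumℤ (map (λ j → (z· f) i j ℤ.* g (suc n ∸ i) (k ∸ j)) (upTo (suc k)))

⊛-Z-Z : ∀ f → f ⊛ Z ⊛ Z ≈ z· z· f
⊛-Z-Z f n k = trans (⊛-Z (f ⊛ Z) n k) (z·-cong (⊛-Z f) n k)

Z-⊛-⊛ : ∀ f g → Z ⊛ f ⊛ g ≈ z· (f ⊛ g)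
Z-⊛-⊛ f g n k = trans (⊛-congˡ g (Z-⊛ f) n k) (z·-⊛ f g n k)

z·[U⊖One] : ∀ a k → (z· (U ⊖ One)) a k ≡ + (𝟙 (a ≡ᵇ 1) * 𝟙 (k ≡ᵇ 1)) ℤ.- + (𝟙 (a ≡ᵇ 1) * 𝟙 (k ≡ᵇ 0))
z·[U⊖One] zero                k             = refl
z·[U⊖One] (suc zero)          zero          = refl
z·[U⊖One] (suc zero)          (suc zero)    = refl
z·[U⊖One] (suc zero)          (suc (suc k)) = refl
z·[U⊖One] (suc (suc a))       k             = refl

Tid⊛Tid : ∀ a k → (Tid ⊛ Tid) a k ≡ + linearCount² a k
Tid⊛Tid a k = begin
  (Tid ⊛ Tid) a k
    ≡⟨ sumℤ-+ (upTo (suc a)) _ _ (λ i → sumℤ-+ (upTo (suc k)) _ _ (λ j → coefficient i j)) ⟩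
  + ∑ (upTo (suc a)) (λ i → ∑ (upTo (suc k)) (λ j → linearCount i j * linearCount (a ∸ i) (k ∸ j)))
    ≡⟨ cong +_ (trans (conv≡∑upTo a _) (∑-cong (upTo (suc a)) (λ i →
         conv≡∑upTo k (λ k₁ k₂ → linearCount i k₁ * linearCount (a ∸ i) k₂)))) ⟨
  + linearCount² a k ∎
  where
  coefficient : ∀ i j → Tid i j ℤ.* Tid (a ∸ i) (k ∸ j) ≡ + (linearCount i j * linearCount (a ∸ i) (k ∸ j))
  coefficient i j = trans (cong₂ (λ x y → + x ℤ.* + y) (countTid≡linearCount i j) (countTid≡linearCount (a ∸ i) (k ∸ j)))
                          (sym (ℤ.pos-* (linearCount i j) _))

∂u-Tid : ∀ n k → ∂u Tid n k ≡ + (suc k * linearCount n (suc k))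
∂u-Tid n k = trans (cong (λ x → + suc k ℤ.* + x) (countTid≡linearCount n (suc k))) (sym (ℤ.pos-* (suc k) _))

ℕ-identity⇒ℤ : ∀ x w y v u → x + w ≡ y + v + u → + x ≡ + u ℤ.- + w ℤ.+ + y ℤ.+ + v
ℕ-identity⇒ℤ x w y v u eq = begin
  + x                              ≡⟨ addSub (+ x) (+ w) ⟩
  + x ℤ.+ + w ℤ.- + w              ≡⟨ cong (ℤ._- + w) (ℤ.pos-+ x w) ⟨
  + (x + w) ℤ.- + w                ≡⟨ cong (λ n → + n ℤ.- + w) eq ⟩
  + (y + v + u) ℤ.- + w            ≡⟨ cong (ℤ._- + w) (trans (ℤ.pos-+ (y + v) u) (cong (ℤ._+ + u) (ℤ.pos-+ y v))) ⟩
  + y ℤ.+ + v ℤ.+ + u ℤ.- + w      ≡⟨ rotate (+ y) (+ v) (+ u) (+ w) ⟩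
  + u ℤ.- + w ℤ.+ + y ℤ.+ + v      ∎
  where
  addSub : ∀ a b → a ≡ a ℤ.+ b ℤ.- b
  addSub = ℤ-Solver.solve-∀
  rotate : ∀ a b c d → a ℤ.+ b ℤ.+ c ℤ.- d ≡ c ℤ.- d ℤ.+ a ℤ.+ b
  rotate = ℤ-Solver.solve-∀

mainTheorem15 : Tid ≈ (U ⊖ One) ⊛ Z ⊛ Z ⊕ Z ⊛ Tid ⊛ Tid ⊕ ∂u Tid
mainTheorem15 zero k =
  sym (cong₂ ℤ._+_ (cong₂ ℤ._+_ (⊛-Z-Z (U ⊖ One) 0 k) (Z-⊛-⊛ Tid Tid 0 k)) (ℤ.*-zeroʳ (+ suc k)))
mainTheorem15 (suc a) k = begin
  + countTid (suc a) k
    ≡⟨ cong +_ (countTid≡linearCount (suc a) k) ⟩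
  + linearCount (suc a) k
    ≡⟨ ℕ-identity⇒ℤ _ _ _ _ _ (linearCount-suc a k) ⟩
  + (𝟙 (a ≡ᵇ 1) * 𝟙 (k ≡ᵇ 1)) ℤ.- + (𝟙 (a ≡ᵇ 1) * 𝟙 (k ≡ᵇ 0))
    ℤ.+ + linearCount² a k ℤ.+ + (suc k * linearCount (suc a) (suc k))
    ≡⟨ cong₂ ℤ._+_ (cong₂ ℤ._+_ (trans (⊛-Z-Z (U ⊖ One) (suc a) k) (z·[U⊖One] a k))
                                (trans (Z-⊛-⊛ Tid Tid (suc a) k) (Tid⊛Tid a k)))
                   (∂u-Tid (suc a) k) ⟨
  ((U ⊖ One) ⊛ Z ⊛ Z ⊕ Z ⊛ Tid ⊛ Tid ⊕ ∂u Tid) (suc a) k ∎
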